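{- Let $i,j,k$ be nonnegative integers. Every optimal tour of the instance $I^3_{i,j,k}$ (points in $\mathbb{R}^3$ with $1$-norm distances) has length at least $4+\frac{2}{i+1}+\frac{2}{j+1}+\frac{2}{k+1}$.
   Context: $I^3_{i,j,k}$ is the \textsc{Multidimensional Rectilinear TSP} instance with the $i+j+k+6$ points $X_s=\left(0,0,\frac{s}{i+1}\right)$ for $0\le s\le i+1$, $Y_s=\left(\frac{1}{i+1}+\frac{1}{j+1},0,\frac{s}{j+1}\right)$ for $0\le s\le j+1$, and $Z_s=\left(\frac{1}{i+1},\frac{1}{k+1},\frac{s}{k+1}\right)$ for $0\le s\le k+1$, where the distance between two points $u,v$ is $\|u-v\|_1$. An optimal tour is a Hamiltonian cycle through all points of minimum total length. -}

module Defs where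

open import Data.Nat using (ℕ; suc)
open import Data.Integer using (+_)
open import Data.Rational using (ℚ; 0ℚ; _+_; _-_; ∣_∣; _/_; _≤_)
open import Data.Product using (_×_; _,_)
open import Data.List using (List; []; _∷_; _++_; map; upTo)
open import Data.List.Relation.Binary.Permutation.Propositional using (_↭_)

-- points of ℚ³ (all coordinates of the instance are rational)
Point : Set
Point = ℚ × ℚ × ℚ

dist : Point → Point → ℚ
dist (a , b , c) (a' , b' , c') = ∣ a - a' ∣ + ∣ b - b' ∣ + ∣ c - c' ∣

inv : ℕ → ℚ
inv n = (+ 1) / suc n

Xpt : ℕ → ℕ → Point
Xpt i s = (0ℚ , 0ℚ , (+ s) / suc i)

Ypt : ℕ → ℕ → ℕ → Point
Ypt i j s = (inv i + inv j , 0ℚ , (+ s) / suc j)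

Zpt : ℕ → ℕ → ℕ → Point
Zpt i k s = (inv i , inv k , (+ s) / suc k)

-- the instance I^3_{i,j,k} as the list of its i+j+k+6 points
-- (upTo m = [0, …, m-1])
I3 : ℕ → ℕ → ℕ → List Point
I3 i j k = map (Xpt i) (upTo (suc (suc i)))
        ++ map (Ypt i j) (upTo (suc (suc j)))
        ++ map (Zpt i k) (upTo (suc (suc k)))

cycleLength : List Point → ℚ
cycleLength [] = 0ℚ
cycleLength (p ∷ ps) = go (p ∷ ps)
  where
  go : List Point → ℚ
  go [] = 0ℚ
  go (x ∷ []) = dist x p
  go (x ∷ y ∷ r) = dist x y + go (y ∷ r)

-- a tour (Hamiltonian cycle) is a cyclic ordering of all the points,
-- i.e. a list that is a permutation of the point list
IsTour : List Point → List Point → Set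
IsTour I T = T ↭ I

IsOptimalTour : List Point → List Point → Set
IsOptimalTour I T = IsTour I T × (∀ T' → IsTour I T' → cycleLength T ≤ cycleLength T')

{-# OPTIONS --safe #-}

-- Scaling every coordinate by N = (i+1)(j+1)(k+1) puts the points on three vertical lines X, Y, Z
-- at integer heights 0, h_L, 2 h_L, …, N, where h_X = N/(i+1), h_Y = N/(j+1), h_Z = N/(k+1), and
-- the horizontal distance between two lines is the sum of their values of h. So the scaled length
-- of a tour is at least the number of its crossings of the N planes at heights l + 1/2, plus
-- Σ_L h_L times the number of its edges leaving line L.
-- A closed tour crosses every plane an even, positive number of times; it crosses it at least four
-- times unless, for some line, no edge of the tour within that line crosses the plane.
-- Along a line, cut the points at every gap between consecutive heights that no edge within the
-- line crosses: the tour must enter and leave each resulting block, so each such gap of L costs at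
-- least two more exits from L, i.e. 2 h_L of horizontal length, which pays for the h_L planes
-- that the gap lets the tour cross only twice. Altogether the scaled length is at least
-- 4N + 2(h_X + h_Y + h_Z).

module Submission where

open import Defs

open import Data.Bool.Base using (Bool; true; false; T; not; _∧_; _∨_; _xor_)
open import Data.Bool.Properties using (xor-same)
open import Data.Empty using (⊥-elim)
open import Data.Integer.Base as ℤ using (ℤ)
import Data.Integer.Properties as ℤ
open import Data.Integer.Tactic.RingSolver using () renaming (solve-∀ to ℤ-solve-∀)
open import Data.List.Base using (List; []; _∷_; _++_; map; upTo)
open import Data.List.Properties using (map-++; map-∘)
open import Data.List.Membership.Propositional using (_∈_)
open import Data.List.Membership.Propositional.Properties using (∈-map⁺; ∈-++⁺ˡ; ∈-++⁺ʳ; ∈-upTo⁺)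
open import Data.List.Relation.Binary.Permutation.Propositional using (_↭_; ↭-sym)
open import Data.List.Relation.Binary.Permutation.Propositional.Properties using (∈-resp-↭; ↭-map-inv)
open import Data.List.Relation.Unary.Any using (here; there)
open import Data.Nat.Base as ℕ
  using (ℕ; zero; suc; _+_; _*_; _∸_; _≤_; _<_; z≤n; s≤s; _<ᵇ_; _≡ᵇ_; ∣_-_∣; parity)
open import Data.Nat.Properties
open import Data.Nat.Tactic.RingSolver using (solve-∀)
open import Data.Parity.Base as ℙ using (Parity; 0ℙ; 1ℙ)
import Data.Parity.Properties as ℙ
open import Data.Product using (∃-syntax; _×_; _,_; proj₁; proj₂)
open import Data.Rational.Base as ℚ using (ℚ; 0ℚ; _/_)
import Data.Rational.Properties as ℚ
open import Data.Rational.Unnormalised.Base as ℚᵘ using (mkℚᵘ)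
import Data.Rational.Unnormalised.Properties as ℚᵘ
open import Data.Sum.Base using (inj₁; inj₂)
open import Function.Base using (_∘_)
open import Relation.Binary.PropositionalEquality
open import Relation.Unary using (_⊆_)
open import Algebra.Properties.AbelianGroup ℚ.+-0-abelianGroup using (xyx⁻¹≈y; ⁻¹-anti-homo‿-)
open import Algebra.Properties.CommutativeSemigroup +-commutativeSemigroup using (interchange)

⟦_⟧ : Bool → ℕ
⟦ true ⟧ = 1
⟦ false ⟧ = 0

⟦xor⟧≡0⇒≡ : ∀ a b → ⟦ a xor b ⟧ ≡ 0 → a ≡ b
⟦xor⟧≡0⇒≡ false false _ = refl
⟦xor⟧≡0⇒≡ true true _ = refl
⟦xor⟧≡0⇒≡ false true ()
⟦xor⟧≡0⇒≡ true false ()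

exits≡xor : ∀ a b → (a ∧ not b) ∨ (b ∧ not a) ≡ a xor b
exits≡xor false false = refl
exits≡xor false true = refl
exits≡xor true false = refl
exits≡xor true true = refl

T-contrapose : ∀ {a b} → (T a → T b) → b ≡ false → a ≡ false
T-contrapose {false} _ _ = refl
T-contrapose {true} a⇒b refl = ⊥-elim (a⇒b _)

<ᵇ-true : ∀ {m n} → m < n → (m <ᵇ n) ≡ true
<ᵇ-true {zero} (s≤s _) = refl
<ᵇ-true {suc m} (s≤s m<n) = <ᵇ-true m<n

<ᵇ-false : ∀ {m n} → n ≤ m → (m <ᵇ n) ≡ false
<ᵇ-false z≤n = refl
<ᵇ-false (s≤s n≤m) = <ᵇ-false n≤m

+-cancelˡ-<ᵇ : ∀ H a b → (H + a <ᵇ suc (H + b)) ≡ (a <ᵇ suc b)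
+-cancelˡ-<ᵇ zero a b = refl
+-cancelˡ-<ᵇ (suc H) a b = +-cancelˡ-<ᵇ H a b

*-<ᵇ-block : ∀ {H t} → t < H → ∀ s g → (s * H <ᵇ suc (g * H + t)) ≡ (s <ᵇ suc g)
*-<ᵇ-block t<H zero g = refl
*-<ᵇ-block {H} t<H (suc s) zero = <ᵇ-false (≤-trans t<H (m≤m+n H (s * H)))
*-<ᵇ-block {H} {t} t<H (suc s) (suc g) = begin
  (H + s * H <ᵇ suc (H + g * H + t))   ≡⟨ cong (λ k → H + s * H <ᵇ suc k) (+-assoc H (g * H) t) ⟩
  (H + s * H <ᵇ suc (H + (g * H + t))) ≡⟨ +-cancelˡ-<ᵇ H (s * H) (g * H + t) ⟩
  (s * H <ᵇ suc (g * H + t))           ≡⟨ *-<ᵇ-block t<H s g ⟩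
  (s <ᵇ suc g)                         ∎
  where open ≡-Reasoning

∑< : ℕ → (ℕ → ℕ) → ℕ
∑< zero f = 0
∑< (suc n) f = f 0 + ∑< n (f ∘ suc)

syntax ∑< n (λ l → e) = ∑[ l < n ] e

∑-cong : ∀ n {f g : ℕ → ℕ} → (∀ l → l < n → f l ≡ g l) → ∑< n f ≡ ∑< n g
∑-cong zero f≗g = refl
∑-cong (suc n) f≗g = cong₂ _+_ (f≗g 0 (s≤s z≤n)) (∑-cong n (λ l l<n → f≗g (suc l) (s≤s l<n)))

∑-mono-≤ : ∀ n {f g : ℕ → ℕ} → (∀ l → l < n → f l ≤ g l) → ∑< n f ≤ ∑< n g
∑-mono-≤ zero f≤g = z≤n
∑-mono-≤ (suc n) f≤g = +-mono-≤ (f≤g 0 (s≤s z≤n)) (∑-mono-≤ n (λ l l<n → f≤g (suc l) (s≤s l<n)))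

∑-distrib-+ : ∀ n (f g : ℕ → ℕ) → ∑[ l < n ] (f l + g l) ≡ ∑< n f + ∑< n g
∑-distrib-+ zero f g = refl
∑-distrib-+ (suc n) f g =
  trans (cong (f 0 + g 0 +_) (∑-distrib-+ n (f ∘ suc) (g ∘ suc))) (interchange (f 0) (g 0) _ _)

∑-const : ∀ n c → ∑[ l < n ] c ≡ n * c
∑-const zero c = refl
∑-const (suc n) c = cong (c +_) (∑-const n c)

∑-distribˡ-* : ∀ n c (f : ℕ → ℕ) → ∑[ l < n ] (c * f l) ≡ c * ∑< n f
∑-distribˡ-* zero c f = sym (*-zeroʳ c)
∑-distribˡ-* (suc n) c f = trans (cong (c * f 0 +_) (∑-distribˡ-* n c (f ∘ suc))) (sym (*-distribˡ-+ c (f 0) _))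

∑-suc : ∀ n (f : ℕ → ℕ) → ∑< (suc n) f ≡ ∑< n f + f n
∑-suc zero f = +-comm (f 0) 0
∑-suc (suc n) f = trans (cong (f 0 +_) (∑-suc n (f ∘ suc))) (sym (+-assoc (f 0) _ _))

∑-+-range : ∀ a b (f : ℕ → ℕ) → ∑< (a + b) f ≡ ∑< a f + ∑[ t < b ] f (a + t)
∑-+-range zero b f = refl
∑-+-range (suc a) b f = trans (cong (f 0 +_) (∑-+-range a b (f ∘ suc))) (sym (+-assoc (f 0) _ _))

∑-*-range : ∀ m H (f : ℕ → ℕ) → ∑< (m * H) f ≡ ∑[ g < m ] ∑[ t < H ] f (g * H + t)
∑-*-range zero H f = refl
∑-*-range (suc m) H f = trans (∑-+-range H (m * H) f) (cong (∑< H f +_)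
  (trans (∑-*-range m H (λ l → f (H + l)))
         (∑-cong m (λ g _ → ∑-cong H (λ t _ → cong f (sym (+-assoc H (g * H) t)))))))

separating-levels≤∣-∣ : ∀ a b n → ∑[ l < n ] ⟦ (a <ᵇ suc l) xor (b <ᵇ suc l) ⟧ ≤ ∣ a - b ∣
separating-levels≤∣-∣ a b zero = z≤n
separating-levels≤∣-∣ zero zero (suc n) = ≤-reflexive (trans (∑-const n 0) (*-zeroʳ n))
separating-levels≤∣-∣ zero (suc b) (suc n) = s≤s (separating-levels≤∣-∣ zero b n)
separating-levels≤∣-∣ (suc a) zero (suc n) =
  s≤s (≤-trans (separating-levels≤∣-∣ a zero n) (≤-reflexive (∣-∣-identityʳ a)))
separating-levels≤∣-∣ (suc a) (suc b) (suc n) = separating-levels≤∣-∣ a b n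
-- Sums along closed walks

module _ {A : Set} where

  walkSum : (A → A → ℕ) → A → List A → ℕ
  walkSum w e [] = 0
  walkSum w e (x ∷ []) = w x e
  walkSum w e (x ∷ y ∷ r) = w x y + walkSum w e (y ∷ r)

  cycleSum : (A → A → ℕ) → List A → ℕ
  cycleSum w [] = 0
  cycleSum w (x ∷ xs) = walkSum w x (x ∷ xs)

  walkSum-mono-≤ : ∀ {w w' : A → A → ℕ} → (∀ x y → w x y ≤ w' x y) →
                   ∀ e xs → walkSum w e xs ≤ walkSum w' e xs
  walkSum-mono-≤ w≤w' e [] = z≤n
  walkSum-mono-≤ w≤w' e (x ∷ []) = w≤w' x e
  walkSum-mono-≤ w≤w' e (x ∷ y ∷ r) = +-mono-≤ (w≤w' x y) (walkSum-mono-≤ w≤w' e (y ∷ r))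

  cycleSum-mono-≤ : ∀ {w w' : A → A → ℕ} → (∀ x y → w x y ≤ w' x y) →
                    ∀ xs → cycleSum w xs ≤ cycleSum w' xs
  cycleSum-mono-≤ w≤w' [] = z≤n
  cycleSum-mono-≤ w≤w' (x ∷ xs) = walkSum-mono-≤ w≤w' x (x ∷ xs)

  cycleSum-cong : ∀ {w w' : A → A → ℕ} → (∀ x y → w x y ≡ w' x y) →
                  ∀ xs → cycleSum w xs ≡ cycleSum w' xs
  cycleSum-cong w≗w' xs = ≤-antisym (cycleSum-mono-≤ (λ x y → ≤-reflexive (w≗w' x y)) xs)
                                    (cycleSum-mono-≤ (λ x y → ≤-reflexive (sym (w≗w' x y))) xs)

  walkSum-+ : ∀ (w w' : A → A → ℕ) e xs →
              walkSum (λ x y → w x y + w' x y) e xs ≡ walkSum w e xs + walkSum w' e xs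
  walkSum-+ w w' e [] = refl
  walkSum-+ w w' e (x ∷ []) = refl
  walkSum-+ w w' e (x ∷ y ∷ r) =
    trans (cong (w x y + w' x y +_) (walkSum-+ w w' e (y ∷ r))) (interchange (w x y) (w' x y) _ _)

  cycleSum-+ : ∀ (w w' : A → A → ℕ) xs → cycleSum (λ x y → w x y + w' x y) xs ≡ cycleSum w xs + cycleSum w' xs
  cycleSum-+ w w' [] = refl
  cycleSum-+ w w' (x ∷ xs) = walkSum-+ w w' x (x ∷ xs)

  walkSum-*ʳ : ∀ (w : A → A → ℕ) c e xs → walkSum (λ x y → w x y * c) e xs ≡ walkSum w e xs * c
  walkSum-*ʳ w c e [] = refl
  walkSum-*ʳ w c e (x ∷ []) = refl
  walkSum-*ʳ w c e (x ∷ y ∷ r) =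
    trans (cong (w x y * c +_) (walkSum-*ʳ w c e (y ∷ r))) (sym (*-distribʳ-+ c (w x y) _))

  cycleSum-*ʳ : ∀ (w : A → A → ℕ) c xs → cycleSum (λ x y → w x y * c) xs ≡ cycleSum w xs * c
  cycleSum-*ʳ w c [] = refl
  cycleSum-*ʳ w c (x ∷ xs) = walkSum-*ʳ w c x (x ∷ xs)

  walkSum-zero : ∀ e xs → walkSum (λ _ _ → 0) e xs ≡ 0
  walkSum-zero e [] = refl
  walkSum-zero e (x ∷ []) = refl
  walkSum-zero e (x ∷ y ∷ r) = walkSum-zero e (y ∷ r)

  cycleSum-zero : ∀ {w : A → A → ℕ} → (∀ x y → w x y ≡ 0) → ∀ xs → cycleSum w xs ≡ 0
  cycleSum-zero w≗0 [] = refl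
  cycleSum-zero w≗0 (x ∷ xs) = trans (cycleSum-cong w≗0 (x ∷ xs)) (walkSum-zero x (x ∷ xs))

  cycleSum-∑ : ∀ n (w : ℕ → A → A → ℕ) xs →
               cycleSum (λ x y → ∑[ l < n ] w l x y) xs ≡ ∑[ l < n ] cycleSum (w l) xs
  cycleSum-∑ zero w xs = cycleSum-zero (λ _ _ → refl) xs
  cycleSum-∑ (suc n) w xs = trans (cycleSum-+ (w 0) _ xs) (cong (cycleSum (w 0) xs +_) (cycleSum-∑ n (w ∘ suc) xs))

-- Crossings of a cut

crossing : ∀ {A : Set} → (A → Bool) → A → A → ℕ
crossing P x y = ⟦ P x xor P y ⟧

toParity : Bool → Parity
toParity false = 0ℙ
toParity true = 1ℙ

parity-⟦xor⟧ : ∀ a b → parity ⟦ a xor b ⟧ ≡ toParity a ℙ.+ toParity b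
parity-⟦xor⟧ false false = refl
parity-⟦xor⟧ false true = refl
parity-⟦xor⟧ true false = refl
parity-⟦xor⟧ true true = refl

ℙ-telescope : ∀ a b c → (a ℙ.+ b) ℙ.+ (b ℙ.+ c) ≡ a ℙ.+ c
ℙ-telescope a b c = begin
  (a ℙ.+ b) ℙ.+ (b ℙ.+ c) ≡⟨ ℙ.+-assoc a b (b ℙ.+ c) ⟩
  a ℙ.+ (b ℙ.+ (b ℙ.+ c)) ≡⟨ cong (a ℙ.+_) (ℙ.+-assoc b b c) ⟨
  a ℙ.+ ((b ℙ.+ b) ℙ.+ c) ≡⟨ cong (λ z → a ℙ.+ (z ℙ.+ c)) (ℙ.p+p≡0ℙ b) ⟩
  a ℙ.+ c                 ∎
  where open ≡-Reasoning

even-nonzero⇒≥2 : ∀ n → parity n ≡ 0ℙ → n ≢ 0 → 2 ≤ n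
even-nonzero⇒≥2 zero _ n≢0 = ⊥-elim (n≢0 refl)
even-nonzero⇒≥2 (suc (suc n)) _ _ = s≤s (s≤s z≤n)

even-≥3⇒≥4 : ∀ d → parity d ≡ 0ℙ → 3 ≤ d → 4 ≤ d
even-≥3⇒≥4 zero _ ()
even-≥3⇒≥4 (suc zero) _ (s≤s ())
even-≥3⇒≥4 (suc (suc zero)) _ (s≤s (s≤s ()))
even-≥3⇒≥4 (suc (suc (suc zero))) () _
even-≥3⇒≥4 (suc (suc (suc (suc d)))) _ _ = s≤s (s≤s (s≤s (s≤s z≤n)))

even-bound : ∀ d a b c → parity d ≡ 0ℙ → 2 ≤ d → a + b + c ≤ d →
  4 ≤ d + 2 * (⟦ a ≡ᵇ 0 ⟧ + ⟦ b ≡ᵇ 0 ⟧ + ⟦ c ≡ᵇ 0 ⟧)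
even-bound d zero b c _ 2≤d _ = +-mono-≤ 2≤d (*-monoʳ-≤ 2 (s≤s z≤n))
even-bound d (suc a) zero c _ 2≤d _ = +-mono-≤ 2≤d (*-monoʳ-≤ 2 (s≤s z≤n))
even-bound d (suc a) (suc b) zero _ 2≤d _ = +-mono-≤ 2≤d (*-monoʳ-≤ 2 {1} {1} (s≤s z≤n))
even-bound d (suc a) (suc b) (suc c) even _ a+b+c≤d = ≤-trans
  (even-≥3⇒≥4 d even (≤-trans (+-mono-≤ (+-mono-≤ (s≤s z≤n) (s≤s z≤n)) (s≤s z≤n)) a+b+c≤d))
  (m≤m+n d 0)

module _ {A : Set} (P : A → Bool) where

  walk-crossings-parity : ∀ e x r → parity (walkSum (crossing P) e (x ∷ r)) ≡ toParity (P x) ℙ.+ toParity (P e)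
  walk-crossings-parity e x [] = parity-⟦xor⟧ (P x) (P e)
  walk-crossings-parity e x (y ∷ r) = begin
    parity (crossing P x y + walkSum (crossing P) e (y ∷ r))
      ≡⟨ ℙ.+-homo-+ (crossing P x y) _ ⟩
    parity (crossing P x y) ℙ.+ parity (walkSum (crossing P) e (y ∷ r))
      ≡⟨ cong₂ ℙ._+_ (parity-⟦xor⟧ (P x) (P y)) (walk-crossings-parity e y r) ⟩
    (toParity (P x) ℙ.+ toParity (P y)) ℙ.+ (toParity (P y) ℙ.+ toParity (P e))
      ≡⟨ ℙ-telescope (toParity (P x)) _ _ ⟩
    toParity (P x) ℙ.+ toParity (P e) ∎
    where open ≡-Reasoning

  crossings-even : ∀ xs → parity (cycleSum (crossing P) xs) ≡ 0ℙ
  crossings-even [] = refl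
  crossings-even (x ∷ xs) = trans (walk-crossings-parity x x xs) (ℙ.p+p≡0ℙ (toParity (P x)))

  crossing-free-walk : ∀ e x r → walkSum (crossing P) e (x ∷ r) ≡ 0 → ∀ {y} → y ∈ x ∷ r → P y ≡ P x
  crossing-free-walk e x r _ (here refl) = refl
  crossing-free-walk e x (z ∷ r) free (there y∈) =
    trans (crossing-free-walk e z r (m+n≡0⇒n≡0 (crossing P x z) free) y∈)
          (sym (⟦xor⟧≡0⇒≡ (P x) (P z) (m+n≡0⇒m≡0 (crossing P x z) free)))

  crossings-≥2 : ∀ {xs x y} → x ∈ xs → y ∈ xs → P x ≡ true → P y ≡ false → 2 ≤ cycleSum (crossing P) xs
  crossings-≥2 {z ∷ zs} x∈ y∈ Px Py = even-nonzero⇒≥2 _ (crossings-even (z ∷ zs)) separated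
    where
    separated : cycleSum (crossing P) (z ∷ zs) ≢ 0
    separated free with () ← trans (sym Px) (trans (crossing-free-walk z z zs free x∈)
                                             (trans (sym (crossing-free-walk z z zs free y∈)) Py))

-- Crossings of a line

-- The possible values of (x ∈ S, x ∈ S', x on the line) for sets S ⊆ S' ⊆ line.
data Nest : Bool → Bool → Bool → Set where
  inner  : Nest true  true  true
  middle : Nest false true  true
  outer  : Nest false false true
  off    : Nest false false false

nest : ∀ {s s' o} → (T s → T s') → (T s' → T o) → Nest s s' o
nest {true}  {true}  {true}  _ _ = inner
nest {false} {true}  {true}  _ _ = middle
nest {false} {false} {true}  _ _ = outer
nest {false} {false} {false} _ _ = off
nest {true}  {false}         s⊆s' _ = ⊥-elim (s⊆s' _)
nest {_}     {true}  {false} _ s'⊆o = ⊥-elim (s'⊆o _)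

nested-crossing : ∀ {s s' o t t' p} → Nest s s' o → Nest t t' p →
  ⟦ (s' ∧ not s) xor (t' ∧ not t) ⟧ + ⟦ (s ∧ not p) ∨ (t ∧ not o) ⟧
    ≤ ⟦ o ∧ p ∧ (s xor t) ⟧ + ⟦ o ∧ p ∧ (s' xor t') ⟧ + ⟦ (s' ∧ not p) ∨ (t' ∧ not o) ⟧
nested-crossing inner  inner  = z≤n
nested-crossing inner  middle = s≤s z≤n
nested-crossing inner  outer  = z≤n
nested-crossing inner  off    = s≤s z≤n
nested-crossing middle inner  = s≤s z≤n
nested-crossing middle middle = z≤n
nested-crossing middle outer  = s≤s z≤n
nested-crossing middle off    = s≤s z≤n
nested-crossing outer  inner  = z≤n
nested-crossing outer  middle = s≤s z≤n
nested-crossing outer  outer  = z≤n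
nested-crossing outer  off    = z≤n
nested-crossing off    inner  = s≤s z≤n
nested-crossing off    middle = s≤s z≤n
nested-crossing off    outer  = z≤n
nested-crossing off    off    = z≤n

module LineCrossings {A : Set} (onLine : A → Bool) (height : A → ℕ) (xs : List A) where

  insideEdge : (A → Bool) → A → A → ℕ
  insideEdge S x y = ⟦ onLine x ∧ onLine y ∧ (S x xor S y) ⟧

  leavingEdge : (A → Bool) → A → A → ℕ
  leavingEdge S x y = ⟦ (S x ∧ not (onLine y)) ∨ (S y ∧ not (onLine x)) ⟧

  inside : (A → Bool) → ℕ
  inside S = cycleSum (insideEdge S) xs

  leaving : (A → Bool) → ℕ
  leaving S = cycleSum (leavingEdge S) xs

  inside-cong : ∀ {S S'} → (∀ x → onLine x ≡ true → S x ≡ S' x) → inside S ≡ inside S'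
  inside-cong {S} {S'} S≗S' = cycleSum-cong edge xs
    where
    edge : ∀ x y → insideEdge S x y ≡ insideEdge S' x y
    edge x y with onLine x in on-x | onLine y in on-y
    ... | false | _ = refl
    ... | true | false = refl
    ... | true | true = cong₂ (λ a b → ⟦ a xor b ⟧) (S≗S' x on-x) (S≗S' y on-y)

  inside-constant : ∀ {S} b → (∀ x → onLine x ≡ true → S x ≡ b) → inside S ≡ 0
  inside-constant {S} b S≗b = cycleSum-zero edge xs
    where
    edge : ∀ x y → insideEdge S x y ≡ 0
    edge x y with onLine x in on-x | onLine y in on-y
    ... | false | _ = refl
    ... | true | false = refl
    ... | true | true rewrite S≗b x on-x | S≗b y on-y | xor-same b = refl

  -- The block S' ∖ S is crossed at least twice, and edge by edge (nested-crossing) each crossing of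
  -- the block or exit from S is an inside crossing of S or of S', or an exit from S'.
  leaving-step : ∀ {S S'} → (T ∘ S) ⊆ (T ∘ S') → (T ∘ S') ⊆ (T ∘ onLine) → inside S ≡ 0 → inside S' ≡ 0 →
    ∀ {x y} → x ∈ xs → S' x ≡ true → S x ≡ false → y ∈ xs → onLine y ≡ false →
    leaving S + 2 ≤ leaving S'
  leaving-step {S} {S'} S⊆S' S'⊆L no-inside-S no-inside-S' {x} {y} x∈ S'x Sx y∈ Ly = begin
    leaving S + 2                                    ≤⟨ +-monoʳ-≤ (leaving S) block-crossed ⟩
    leaving S + cycleSum (crossing block) xs         ≡⟨ +-comm (leaving S) _ ⟩
    cycleSum (crossing block) xs + leaving S         ≡⟨ cycleSum-+ (crossing block) (leavingEdge S) xs ⟨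
    cycleSum (λ a b → crossing block a b + leavingEdge S a b) xs
      ≤⟨ cycleSum-mono-≤ (λ a b → nested-crossing (nest' a) (nest' b)) xs ⟩
    cycleSum (λ a b → insideEdge S a b + insideEdge S' a b + leavingEdge S' a b) xs
      ≡⟨ cycleSum-+ (λ a b → insideEdge S a b + insideEdge S' a b) (leavingEdge S') xs ⟩
    cycleSum (λ a b → insideEdge S a b + insideEdge S' a b) xs + leaving S'
      ≡⟨ cong (_+ leaving S') (cycleSum-+ (insideEdge S) (insideEdge S') xs) ⟩
    inside S + inside S' + leaving S'                ≡⟨ cong₂ (λ a b → a + b + leaving S') no-inside-S no-inside-S' ⟩
    leaving S'                                       ∎
    where
    open ≤-Reasoning
    block : A → Bool
    block a = S' a ∧ not (S a)
    nest' : ∀ a → Nest (S a) (S' a) (onLine a)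
    nest' a = nest S⊆S' S'⊆L
    block-crossed : 2 ≤ cycleSum (crossing block) xs
    block-crossed = crossings-≥2 block x∈ y∈ (cong₂ (λ a b → a ∧ not b) S'x Sx)
                                                (cong (_∧ not (S y)) (T-contrapose S'⊆L Ly))

  leaving-line : leaving onLine ≡ cycleSum (crossing onLine) xs
  leaving-line = cycleSum-cong (λ x y → cong ⟦_⟧ (exits≡xor (onLine x) (onLine y))) xs

  below : ℕ → A → Bool
  below n x = onLine x ∧ (height x <ᵇ n)

  below-on-line : ∀ {x} n → onLine x ≡ true → below n x ≡ (height x <ᵇ n)
  below-on-line n on-x rewrite on-x = refl

  below-⊆ : ∀ {a b} → a ≤ b → (T ∘ below a) ⊆ (T ∘ below b)
  below-⊆ a≤b {x} x<a with onLine x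
  ... | true = <⇒<ᵇ (<-≤-trans (<ᵇ⇒< _ _ x<a) a≤b)
  ... | false = x<a

  below-⊆-line : ∀ {n} → (T ∘ below n) ⊆ (T ∘ onLine)
  below-⊆-line {n} {x} x<n with onLine x
  ... | true = _
  ... | false = x<n

  uncrossed : ℕ → ℕ
  uncrossed g = ⟦ inside (below (suc g)) ≡ᵇ 0 ⟧

  module _ (m : ℕ) (on-line-at : ∀ g → g ≤ m → ∃[ x ] x ∈ xs × onLine x ≡ true × height x ≡ g)
           (off-line : ∃[ y ] y ∈ xs × onLine y ≡ false) where

    leaving-past : ∀ {a g S'} → a ≤ g → g ≤ m → inside (below a) ≡ 0 → inside S' ≡ 0 →
      (T ∘ below a) ⊆ (T ∘ S') → (T ∘ S') ⊆ (T ∘ onLine) →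
      (∀ x → onLine x ≡ true → height x ≡ g → S' x ≡ true) →
      leaving (below a) + 2 ≤ leaving S'
    leaving-past {a} a≤g g≤m quiet-a quiet-S' a⊆S' S'⊆L S'∋g with on-line-at _ g≤m
    ... | x , x∈ , on-x , refl = leaving-step a⊆S' S'⊆L quiet-a quiet-S'
      x∈ (S'∋g x on-x refl) (trans (below-on-line a on-x) (<ᵇ-false a≤g))
      (proj₁ (proj₂ off-line)) (proj₂ (proj₂ off-line))

    -- Invariant of the sweep up the line: a is an uncrossed threshold, and each uncrossed gap
    -- below n has already been paid for by two exits from below a.
    Charged : ℕ → Set
    Charged n = ∃[ a ] a ≤ n × inside (below a) ≡ 0 × 2 * ∑< n uncrossed ≤ leaving (below a)

    charged-zero : Charged 0
    charged-zero = 0 , z≤n , inside-constant false (λ _ → below-on-line 0) , z≤n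

    charged-suc : ∀ n → suc n ≤ m → Charged n → Charged (suc n)
    charged-suc n sn≤m (a , a≤n , quiet-a , paid) with inside (below (suc n)) in quiet
    ... | zero = suc n , ≤-refl , quiet , (begin
      2 * ∑< (suc n) uncrossed           ≡⟨ cong (2 *_) (∑-suc n uncrossed) ⟩
      2 * (∑< n uncrossed + uncrossed n) ≡⟨ cong (λ k → 2 * (∑< n uncrossed + ⟦ k ≡ᵇ 0 ⟧)) quiet ⟩
      2 * (∑< n uncrossed + 1)           ≡⟨ *-distribˡ-+ 2 (∑< n uncrossed) 1 ⟩
      2 * ∑< n uncrossed + 2             ≤⟨ +-monoˡ-≤ 2 paid ⟩
      leaving (below a) + 2              ≤⟨ leaving-past a≤n (≤-trans (n≤1+n n) sn≤m) quiet-a quiet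
                                              (below-⊆ {a} (m≤n⇒m≤1+n a≤n)) (below-⊆-line {suc n})
                                              (λ _ on-x x≡n → trans (below-on-line (suc n) on-x)
                                                                    (<ᵇ-true (s≤s (≤-reflexive x≡n)))) ⟩
      leaving (below (suc n))            ∎)
      where open ≤-Reasoning
    ... | suc _ = a , m≤n⇒m≤1+n a≤n , quiet-a , (begin
      2 * ∑< (suc n) uncrossed           ≡⟨ cong (2 *_) (∑-suc n uncrossed) ⟩
      2 * (∑< n uncrossed + uncrossed n) ≡⟨ cong (λ k → 2 * (∑< n uncrossed + ⟦ k ≡ᵇ 0 ⟧)) quiet ⟩
      2 * (∑< n uncrossed + 0)           ≡⟨ cong (2 *_) (+-identityʳ (∑< n uncrossed)) ⟩
      2 * ∑< n uncrossed                 ≤⟨ paid ⟩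
      leaving (below a)                  ∎)
      where open ≤-Reasoning

    charged : ∀ n → n ≤ m → Charged n
    charged zero _ = charged-zero
    charged (suc n) sn≤m = charged-suc n sn≤m (charged n (≤-trans (n≤1+n n) sn≤m))

    line-crossings : 2 + 2 * ∑< m uncrossed ≤ cycleSum (crossing onLine) xs
    line-crossings with charged m ≤-refl
    ... | a , a≤m , quiet-a , paid = begin
      2 + 2 * ∑< m uncrossed ≡⟨ +-comm 2 _ ⟩
      2 * ∑< m uncrossed + 2 ≤⟨ +-monoˡ-≤ 2 paid ⟩
      leaving (below a) + 2  ≤⟨ leaving-past a≤m ≤-refl quiet-a (inside-constant true (λ _ on-x → on-x))
                                  (below-⊆-line {a}) (λ on-x → on-x) (λ _ on-x _ → on-x) ⟩
      leaving onLine         ≡⟨ leaving-line ⟩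
      cycleSum (crossing onLine) xs ∎
      where open ≤-Reasoning

-- Three lines of points

data Line : Set where
  X Y Z : Line

sameLine : Line → Line → Bool
sameLine X X = true
sameLine Y Y = true
sameLine Z Z = true
sameLine _ _ = false

sameLine-refl : ∀ L → sameLine L L ≡ true
sameLine-refl X = refl
sameLine-refl Y = refl
sameLine-refl Z = refl

sameLine⇒≡ : ∀ L L' → sameLine L L' ≡ true → L ≡ L'
sameLine⇒≡ X X _ = refl
sameLine⇒≡ Y Y _ = refl
sameLine⇒≡ Z Z _ = refl
sameLine⇒≡ X Y ()
sameLine⇒≡ X Z ()
sameLine⇒≡ Y X ()
sameLine⇒≡ Y Z ()
sameLine⇒≡ Z X ()
sameLine⇒≡ Z Y ()

other : Line → Line
other X = Y
other Y = X
other Z = X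

sameLine-other : ∀ L → sameLine L (other L) ≡ false
sameLine-other X = refl
sameLine-other Y = refl
sameLine-other Z = refl

lineSum : (Line → ℕ) → ℕ
lineSum f = f X + f Y + f Z

lineSum-cong : ∀ {f g : Line → ℕ} → (∀ L → f L ≡ g L) → lineSum f ≡ lineSum g
lineSum-cong f≗g = cong₂ _+_ (cong₂ _+_ (f≗g X) (f≗g Y)) (f≗g Z)

lineSum-mono-≤ : ∀ {f g : Line → ℕ} → (∀ L → f L ≤ g L) → lineSum f ≤ lineSum g
lineSum-mono-≤ f≤g = +-mono-≤ (+-mono-≤ (f≤g X) (f≤g Y)) (f≤g Z)

∑-lineSum : ∀ n (f : Line → ℕ → ℕ) → ∑[ l < n ] lineSum (λ L → f L l) ≡ lineSum (λ L → ∑< n (f L))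
∑-lineSum n f = begin
  ∑[ l < n ] (f X l + f Y l + f Z l)          ≡⟨ ∑-distrib-+ n (λ l → f X l + f Y l) (f Z) ⟩
  ∑[ l < n ] (f X l + f Y l) + ∑< n (f Z)     ≡⟨ cong (_+ ∑< n (f Z)) (∑-distrib-+ n (f X) (f Y)) ⟩
  ∑< n (f X) + ∑< n (f Y) + ∑< n (f Z)        ∎
  where open ≡-Reasoning

cycleSum-lineSum : ∀ {A : Set} (w : Line → A → A → ℕ) xs →
  cycleSum (λ x y → lineSum (λ L → w L x y)) xs ≡ lineSum (λ L → cycleSum (w L) xs)
cycleSum-lineSum w xs = begin
  cycleSum (λ x y → w X x y + w Y x y + w Z x y) xs        ≡⟨ cycleSum-+ (λ x y → w X x y + w Y x y) (w Z) xs ⟩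
  cycleSum (λ x y → w X x y + w Y x y) xs + cycleSum (w Z) xs
    ≡⟨ cong (_+ cycleSum (w Z) xs) (cycleSum-+ (w X) (w Y) xs) ⟩
  cycleSum (w X) xs + cycleSum (w Y) xs + cycleSum (w Z) xs ∎
  where open ≡-Reasoning

-- (L , s) is the point of line L at index s from the bottom.
Code : Set
Code = Line × ℕ

on : Line → Code → Bool
on L (L' , _) = sameLine L L'

module Grid (m h : Line → ℕ) (N : ℕ) (m*h≡N : ∀ L → m L * h L ≡ N) where

  x₀ y₀ : Line → ℕ
  x₀ X = 0
  x₀ Y = h X + h Y
  x₀ Z = h X
  y₀ X = 0
  y₀ Y = 0
  y₀ Z = h Z

  altitude : Code → ℕ
  altitude (L , s) = s * h L

  gridDist : Code → Code → ℕ
  gridDist (L , s) (L' , s') = ∣ x₀ L - x₀ L' ∣ + ∣ y₀ L - y₀ L' ∣ + ∣ s * h L - s' * h L' ∣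

  feet-distance : ∀ L L' →
    lineSum (λ M → ⟦ sameLine M L xor sameLine M L' ⟧ * h M) ≡ ∣ x₀ L - x₀ L' ∣ + ∣ y₀ L - y₀ L' ∣
  feet-distance X X = refl
  feet-distance Y Y = sym (trans (+-identityʳ _) (∣n-n∣≡0 (h X + h Y)))
  feet-distance Z Z = sym (cong₂ _+_ (∣n-n∣≡0 (h X)) (∣n-n∣≡0 (h Z)))
  feet-distance X Y = cong (_+ 0) (cong₂ _+_ (+-identityʳ (h X)) (+-identityʳ (h Y)))
  feet-distance Y X = cong (_+ 0) (trans (cong₂ _+_ (+-identityʳ (h X)) (+-identityʳ (h Y))) (sym (∣-∣-identityʳ _)))
  feet-distance X Z = cong₂ _+_ (trans (+-identityʳ _) (+-identityʳ (h X))) (+-identityʳ (h Z))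
  feet-distance Z X = cong₂ _+_ (trans (trans (+-identityʳ _) (+-identityʳ (h X))) (sym (∣-∣-identityʳ (h X))))
                                (trans (+-identityʳ (h Z)) (sym (∣-∣-identityʳ (h Z))))
  feet-distance Y Z = cong₂ _+_ (trans (+-identityʳ (h Y))
                                       (sym (trans (∣-∣-comm (h X + h Y) (h X)) (∣m-m+n∣≡n (h X) (h Y)))))
                                (+-identityʳ (h Z))
  feet-distance Z Y = cong₂ _+_ (trans (+-identityʳ (h Y)) (sym (∣m-m+n∣≡n (h X) (h Y))))
                                (trans (+-identityʳ (h Z)) (sym (∣-∣-identityʳ (h Z))))

  -- the points at or below the plane at height l + 1/2
  level : ℕ → Code → Bool
  level l c = altitude c <ᵇ suc l

  vertical horizontal : Code → Code → ℕ
  vertical c c' = ∑[ l < N ] crossing (level l) c c'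
  horizontal c c' = lineSum (λ L → crossing (on L) c c' * h L)

  gridDist-split : ∀ c c' → vertical c c' + horizontal c c' ≤ gridDist c c'
  gridDist-split (L , s) (L' , s') =
    ≤-trans (≤-reflexive (+-comm (vertical (L , s) (L' , s')) _))
            (+-mono-≤ (≤-reflexive (feet-distance L L')) (separating-levels≤∣-∣ (s * h L) (s' * h L') N))

  allCodes : List Code
  allCodes = map (X ,_) (upTo (suc (m X))) ++ map (Y ,_) (upTo (suc (m Y))) ++ map (Z ,_) (upTo (suc (m Z)))

  ∈-allCodes : ∀ L {s} → s ≤ m L → (L , s) ∈ allCodes
  ∈-allCodes X s≤m = ∈-++⁺ˡ (∈-map⁺ (X ,_) (∈-upTo⁺ (s≤s s≤m)))
  ∈-allCodes Y s≤m = ∈-++⁺ʳ (map (X ,_) (upTo (suc (m X))))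
                       (∈-++⁺ˡ (∈-map⁺ (Y ,_) (∈-upTo⁺ (s≤s s≤m))))
  ∈-allCodes Z s≤m = ∈-++⁺ʳ (map (X ,_) (upTo (suc (m X))))
                       (∈-++⁺ʳ (map (Y ,_) (upTo (suc (m Y)))) (∈-map⁺ (Z ,_) (∈-upTo⁺ (s≤s s≤m))))

  module Tour (cs : List Code) (perm : allCodes ↭ cs) where

    ∈-tour : ∀ L {s} → s ≤ m L → (L , s) ∈ cs
    ∈-tour L s≤m = ∈-resp-↭ perm (∈-allCodes L s≤m)

    module Along (L : Line) = LineCrossings (on L) proj₂ cs

    levelCrossings : ℕ → ℕ
    levelCrossings l = cycleSum (crossing (level l)) cs

    lineCrossings : Line → ℕ
    lineCrossings L = cycleSum (crossing (on L)) cs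

    uncrossedAt : Line → ℕ → ℕ
    uncrossedAt L l = ⟦ Along.inside L (level l) ≡ᵇ 0 ⟧

    insides≤crossing : ∀ S c c' → lineSum (λ L → Along.insideEdge L S c c') ≤ crossing S c c'
    insides≤crossing S (X , _) (X , _) = ≤-reflexive (trans (+-identityʳ _) (+-identityʳ _))
    insides≤crossing S (Y , _) (Y , _) = ≤-reflexive (+-identityʳ _)
    insides≤crossing S (Z , _) (Z , _) = ≤-refl
    insides≤crossing S (X , _) (Y , _) = z≤n
    insides≤crossing S (X , _) (Z , _) = z≤n
    insides≤crossing S (Y , _) (X , _) = z≤n
    insides≤crossing S (Y , _) (Z , _) = z≤n
    insides≤crossing S (Z , _) (X , _) = z≤n
    insides≤crossing S (Z , _) (Y , _) = z≤n

    level-bound : ∀ l → l < N → 4 ≤ levelCrossings l + 2 * lineSum (λ L → uncrossedAt L l)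
    level-bound l l<N = even-bound _ (Along.inside X (level l)) (Along.inside Y (level l)) (Along.inside Z (level l))
      (crossings-even (level l) cs) separated insides
      where
      top-above : level l (X , m X) ≡ false
      top-above = trans (cong (_<ᵇ suc l) (m*h≡N X)) (<ᵇ-false l<N)
      separated : 2 ≤ levelCrossings l
      separated = crossings-≥2 (level l) (∈-tour X z≤n) (∈-tour X ≤-refl) refl top-above
      insides : lineSum (λ L → Along.inside L (level l)) ≤ levelCrossings l
      insides = ≤-trans (≤-reflexive (sym (cycleSum-lineSum (λ L → Along.insideEdge L (level l)) cs)))
                        (cycleSum-mono-≤ (insides≤crossing (level l)) cs)

    level≡below : ∀ L g t → t < h L → ∀ c → on L c ≡ true → level (g * h L + t) c ≡ Along.below L (suc g) c
    level≡below L g t t<h (L' , s) on-c with sameLine⇒≡ L L' on-c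
    ... | refl = trans (*-<ᵇ-block t<h s g) (sym (Along.below-on-line L {L , s} (suc g) on-c))

    uncrossed-blocks : ∀ L → ∑< N (uncrossedAt L) ≡ h L * ∑< (m L) (Along.uncrossed L)
    uncrossed-blocks L = begin
      ∑< N (uncrossedAt L)                                   ≡⟨ cong (λ n → ∑< n (uncrossedAt L)) (m*h≡N L) ⟨
      ∑< (m L * h L) (uncrossedAt L)                         ≡⟨ ∑-*-range (m L) (h L) (uncrossedAt L) ⟩
      ∑[ g < m L ] ∑[ t < h L ] uncrossedAt L (g * h L + t)
        ≡⟨ ∑-cong (m L) (λ g _ → ∑-cong (h L) (λ t t<h →
             cong (λ k → ⟦ k ≡ᵇ 0 ⟧) (Along.inside-cong L (level≡below L g t t<h)))) ⟩
      ∑[ g < m L ] ∑[ t < h L ] Along.uncrossed L g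
        ≡⟨ ∑-cong (m L) (λ g _ → ∑-const (h L) (Along.uncrossed L g)) ⟩
      ∑[ g < m L ] (h L * Along.uncrossed L g)                ≡⟨ ∑-distribˡ-* (m L) (h L) (Along.uncrossed L) ⟩
      h L * ∑< (m L) (Along.uncrossed L)                     ∎
      where open ≡-Reasoning

    line-bound : ∀ L → 2 * h L + 2 * ∑< N (uncrossedAt L) ≤ lineCrossings L * h L
    line-bound L = begin
      2 * h L + 2 * ∑< N (uncrossedAt L)        ≡⟨ cong (λ u → 2 * h L + 2 * u) (uncrossed-blocks L) ⟩
      2 * h L + 2 * (h L * u)                   ≡⟨ ring (h L) u ⟩
      (2 + 2 * u) * h L                         ≤⟨ *-monoˡ-≤ (h L) (Along.line-crossings L (m L) on-line-at off-line) ⟩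
      lineCrossings L * h L                     ∎
      where
      open ≤-Reasoning
      u = ∑< (m L) (Along.uncrossed L)
      ring : ∀ h u → 2 * h + 2 * (h * u) ≡ (2 + 2 * u) * h
      ring = solve-∀
      on-line-at : ∀ g → g ≤ m L → ∃[ c ] c ∈ cs × on L c ≡ true × proj₂ c ≡ g
      on-line-at g g≤m = (L , g) , ∈-tour L g≤m , sameLine-refl L , refl
      off-line : ∃[ c ] c ∈ cs × on L c ≡ false
      off-line = (other L , 0) , ∈-tour (other L) z≤n , sameLine-other L

    tour-split : ∑< N levelCrossings + lineSum (λ L → lineCrossings L * h L) ≤ cycleSum gridDist cs
    tour-split = begin
      ∑< N levelCrossings + lineSum (λ L → lineCrossings L * h L)
        ≡⟨ cong₂ _+_ (cycleSum-∑ N (crossing ∘ level) cs) (trans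
             (cycleSum-lineSum (λ L c c' → crossing (on L) c c' * h L) cs)
             (lineSum-cong (λ L → cycleSum-*ʳ (crossing (on L)) (h L) cs))) ⟨
      cycleSum vertical cs + cycleSum horizontal cs                   ≡⟨ cycleSum-+ vertical horizontal cs ⟨
      cycleSum (λ c c' → vertical c c' + horizontal c c') cs          ≤⟨ cycleSum-mono-≤ gridDist-split cs ⟩
      cycleSum gridDist cs                                            ∎
      where open ≤-Reasoning

    tour-bound : 4 * N + 2 * lineSum h ≤ cycleSum gridDist cs
    tour-bound = begin
      4 * N + 2 * lineSum h                     ≡⟨ cong (_+ 2 * lineSum h) (trans (*-comm 4 N) (sym (∑-const N 4))) ⟩
      ∑[ l < N ] 4 + 2 * lineSum h              ≤⟨ +-monoˡ-≤ (2 * lineSum h) (∑-mono-≤ N level-bound) ⟩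
      ∑[ l < N ] (levelCrossings l + 2 * lineSum (λ L → uncrossedAt L l)) + 2 * lineSum h
                                                ≡⟨ cong (_+ 2 * lineSum h) levels ⟩
      S + 2 * lineSum U + 2 * lineSum h         ≡⟨ ring S (U X) (U Y) (U Z) (h X) (h Y) (h Z) ⟩
      S + lineSum (λ L → 2 * h L + 2 * U L)     ≤⟨ +-monoʳ-≤ S (lineSum-mono-≤ line-bound) ⟩
      S + lineSum (λ L → lineCrossings L * h L) ≤⟨ tour-split ⟩
      cycleSum gridDist cs                      ∎
      where
      open ≤-Reasoning
      S = ∑< N levelCrossings
      U : Line → ℕ
      U L = ∑< N (uncrossedAt L)
      levels : ∑[ l < N ] (levelCrossings l + 2 * lineSum (λ L → uncrossedAt L l)) ≡ S + 2 * lineSum U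
      levels = trans (∑-distrib-+ N levelCrossings _)
        (cong (S +_) (trans (∑-distribˡ-* N 2 _) (cong (2 *_) (∑-lineSum N uncrossedAt))))
      ring : ∀ s a b c p q r →
             s + 2 * (a + b + c) + 2 * (p + q + r) ≡ s + ((2 * p + 2 * a) + (2 * q + 2 * b) + (2 * r + 2 * c))
      ring = solve-∀

-- Rescaling to rationals

open import Data.Integer.Base using (+_)

/-cross : ∀ a b d e → a * suc e ≡ b * suc d → + a / suc d ≡ + b / suc e
/-cross a b d e a*e≡b*d = ℚ.fromℚᵘ-cong {mkℚᵘ (+ a) d} {mkℚᵘ (+ b) e}
  (ℚᵘ.*≡* (trans (sym (ℤ.pos-* a (suc e))) (trans (cong +_ a*e≡b*d) (ℤ.pos-* b (suc d)))))

module Scale (d : ℕ) where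

  ι : ℕ → ℚ
  ι a = + a / suc d

  ι-0 : ι 0 ≡ 0ℚ
  ι-0 = ℚ.0/n≡0 (suc d)

  ι-+ : ∀ a b → ι a ℚ.+ ι b ≡ ι (a + b)
  ι-+ a b = ℚ.toℚᵘ-injective (ℚᵘ.≃-trans (ℚ.toℚᵘ-homo-+ (ι a) (ι b))
    (ℚᵘ.≃-trans (ℚᵘ.+-cong (ℚ.toℚᵘ-fromℚᵘ (mkℚᵘ (+ a) d)) (ℚ.toℚᵘ-fromℚᵘ (mkℚᵘ (+ b) d)))
    (ℚᵘ.≃-trans (ℚᵘ.*≡* cross) (ℚᵘ.≃-sym (ℚ.toℚᵘ-fromℚᵘ (mkℚᵘ (+ (a + b)) d))))))
    where
    s = suc d
    ring : ∀ (x y z : ℤ) → (x ℤ.* y ℤ.+ z ℤ.* y) ℤ.* y ≡ (x ℤ.+ z) ℤ.* (y ℤ.* y)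
    ring = ℤ-solve-∀
    cross : (+ a ℤ.* + s ℤ.+ + b ℤ.* + s) ℤ.* + s ≡ + (a + b) ℤ.* + (s * s)
    cross = trans (ring (+ a) (+ s) (+ b)) (sym (cong₂ ℤ._*_ (ℤ.pos-+ a b) (ℤ.pos-* s s)))

  0≤ι : ∀ a → 0ℚ ℚ.≤ ι a
  0≤ι a = ℚ.nonNegative⁻¹ (ι a) {{ℚ.normalize-nonNeg a (suc d)}}

  ι-mono-≤ : ∀ {a b} → a ≤ b → ι a ℚ.≤ ι b
  ι-mono-≤ {a} {b} a≤b = begin
    ι a                 ≡⟨ ℚ.+-identityʳ (ι a) ⟨
    ι a ℚ.+ 0ℚ          ≤⟨ ℚ.+-monoʳ-≤ (ι a) (0≤ι (b ∸ a)) ⟩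
    ι a ℚ.+ ι (b ∸ a)   ≡⟨ ι-+ a (b ∸ a) ⟩
    ι (a + (b ∸ a))     ≡⟨ cong ι (m+[n∸m]≡n a≤b) ⟩
    ι b                 ∎
    where open ℚ.≤-Reasoning

  ∣ι-ι∣-≥ : ∀ {a b} → b ≤ a → ℚ.∣ ι a ℚ.- ι b ∣ ≡ ι ∣ a - b ∣
  ∣ι-ι∣-≥ {a} {b} b≤a = begin
    ℚ.∣ ι a ℚ.- ι b ∣
      ≡⟨ cong (λ c → ℚ.∣ ι c ℚ.- ι b ∣) (m+[n∸m]≡n b≤a) ⟨
    ℚ.∣ ι (b + (a ∸ b)) ℚ.- ι b ∣          ≡⟨ cong (λ q → ℚ.∣ q ℚ.- ι b ∣) (ι-+ b (a ∸ b)) ⟨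
    ℚ.∣ ι b ℚ.+ ι (a ∸ b) ℚ.- ι b ∣        ≡⟨ cong ℚ.∣_∣ (xyx⁻¹≈y (ι b) (ι (a ∸ b))) ⟩
    ℚ.∣ ι (a ∸ b) ∣                        ≡⟨ ℚ.0≤p⇒∣p∣≡p (0≤ι (a ∸ b)) ⟩
    ι (a ∸ b)                              ≡⟨ cong ι (m≤n⇒∣n-m∣≡n∸m b≤a) ⟨
    ι ∣ a - b ∣                            ∎
    where open ≡-Reasoning

  ∣ι-ι∣ : ∀ a b → ℚ.∣ ι a ℚ.- ι b ∣ ≡ ι ∣ a - b ∣
  ∣ι-ι∣ a b with ≤-total b a
  ... | inj₁ b≤a = ∣ι-ι∣-≥ b≤a
  ... | inj₂ a≤b = begin
    ℚ.∣ ι a ℚ.- ι b ∣           ≡⟨ ℚ.∣-p∣≡∣p∣ (ι a ℚ.- ι b) ⟨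
    ℚ.∣ ℚ.- (ι a ℚ.- ι b) ∣     ≡⟨ cong ℚ.∣_∣ (⁻¹-anti-homo‿- (ι a) (ι b)) ⟩
    ℚ.∣ ι b ℚ.- ι a ∣           ≡⟨ ∣ι-ι∣-≥ a≤b ⟩
    ι ∣ b - a ∣                 ≡⟨ cong ι (∣-∣-comm b a) ⟩
    ι ∣ a - b ∣                 ∎
    where open ≡-Reasoning

  dist-ι : ∀ a b c a' b' c' →
           dist (ι a , ι b , ι c) (ι a' , ι b' , ι c') ≡ ι (∣ a - a' ∣ + ∣ b - b' ∣ + ∣ c - c' ∣)
  dist-ι a b c a' b' c' = begin
    ℚ.∣ ι a ℚ.- ι a' ∣ ℚ.+ ℚ.∣ ι b ℚ.- ι b' ∣ ℚ.+ ℚ.∣ ι c ℚ.- ι c' ∣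
      ≡⟨ cong₂ ℚ._+_ (cong₂ ℚ._+_ (∣ι-ι∣ a a') (∣ι-ι∣ b b')) (∣ι-ι∣ c c') ⟩
    ι ∣ a - a' ∣ ℚ.+ ι ∣ b - b' ∣ ℚ.+ ι ∣ c - c' ∣
      ≡⟨ cong (ℚ._+ ι ∣ c - c' ∣) (ι-+ ∣ a - a' ∣ ∣ b - b' ∣) ⟩
    ι (∣ a - a' ∣ + ∣ b - b' ∣) ℚ.+ ι ∣ c - c' ∣
      ≡⟨ ι-+ (∣ a - a' ∣ + ∣ b - b' ∣) ∣ c - c' ∣ ⟩
    ι (∣ a - a' ∣ + ∣ b - b' ∣ + ∣ c - c' ∣) ∎
    where open ≡-Reasoning

closedWalkLength : Point → List Point → ℚ
closedWalkLength e [] = 0ℚ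
closedWalkLength e (x ∷ []) = dist x e
closedWalkLength e (x ∷ y ∷ r) = dist x y ℚ.+ closedWalkLength e (y ∷ r)

closedWalkLength-unique : ∀ e (G : List Point → ℚ) → G [] ≡ 0ℚ → (∀ x → G (x ∷ []) ≡ dist x e) →
  (∀ x y r → G (x ∷ y ∷ r) ≡ dist x y ℚ.+ G (y ∷ r)) → ∀ xs → G xs ≡ closedWalkLength e xs
closedWalkLength-unique e G G[] G[x] G∷ [] = G[]
closedWalkLength-unique e G G[] G[x] G∷ (x ∷ []) = G[x] x
closedWalkLength-unique e G G[] G[x] G∷ (x ∷ y ∷ r) =
  trans (G∷ x y r) (cong (dist x y ℚ.+_) (closedWalkLength-unique e G G[] G[x] G∷ (y ∷ r)))

-- cycleLength walks along its argument with a local function that cannot be named; its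
-- defining equations are all this proof needs, so the function is found by unification.
mutual
  cycleLength-walk : Point → List Point → List Point → ℚ
  cycleLength-walk = _

  cycleLength≡closedWalkLength : ∀ x xs → cycleLength (x ∷ xs) ≡ closedWalkLength x (x ∷ xs)
  cycleLength≡closedWalkLength x xs with x ∷ xs
  ... | ys = closedWalkLength-unique x (cycleLength-walk x xs) refl (λ _ → refl) (λ _ _ _ → refl) ys

module _ (d : ℕ) {A : Set} (f : A → Point) (w : A → A → ℕ) where
  open Scale d

  module _ (dist≡ι : ∀ x y → dist (f x) (f y) ≡ ι (w x y)) where

    closedWalkLength-map : ∀ e xs → closedWalkLength (f e) (map f xs) ≡ ι (walkSum w e xs)
    closedWalkLength-map e [] = sym ι-0
    closedWalkLength-map e (x ∷ []) = dist≡ι x e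
    closedWalkLength-map e (x ∷ y ∷ r) =
      trans (cong₂ ℚ._+_ (dist≡ι x y) (closedWalkLength-map e (y ∷ r))) (ι-+ (w x y) (walkSum w e (y ∷ r)))

    cycleLength-map : ∀ xs → cycleLength (map f xs) ≡ ι (cycleSum w xs)
    cycleLength-map [] = sym ι-0
    cycleLength-map (x ∷ xs) = trans (cycleLength≡closedWalkLength (f x) (map f xs)) (closedWalkLength-map x (x ∷ xs))

module Instance (i j k : ℕ) where

  side : Line → ℕ
  side X = i
  side Y = j
  side Z = k

  m : Line → ℕ
  m L = suc (side L)

  h : Line → ℕ
  h X = m Y * m Z
  h Y = m X * m Z
  h Z = m X * m Y

  N : ℕ
  N = m X * (m Y * m Z)

  m*h≡N : ∀ L → m L * h L ≡ N
  m*h≡N X = refl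
  m*h≡N Y = ring (m X) (m Y) (m Z)
    where
    ring : ∀ a b c → b * (a * c) ≡ a * (b * c)
    ring = solve-∀
  m*h≡N Z = ring (m X) (m Y) (m Z)
    where
    ring : ∀ a b c → c * (a * b) ≡ a * (b * c)
    ring = solve-∀

  open Grid m h N m*h≡N
  open Scale (ℕ.pred N)

  /m≡ι : ∀ L a → + a / m L ≡ ι (a * h L)
  /m≡ι L a = /-cross a (a * h L) (side L) (ℕ.pred N) (begin
    a * N             ≡⟨ cong (a *_) (m*h≡N L) ⟨
    a * (m L * h L)   ≡⟨ cong (a *_) (*-comm (m L) (h L)) ⟩
    a * (h L * m L)   ≡⟨ *-assoc a (h L) (m L) ⟨
    a * h L * m L     ∎)
    where open ≡-Reasoning

  inv≡ι : ∀ L → inv (side L) ≡ ι (h L)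
  inv≡ι L = trans (/m≡ι L 1) (cong ι (*-identityˡ (h L)))

  point : Code → Point
  point (X , s) = Xpt i s
  point (Y , s) = Ypt i j s
  point (Z , s) = Zpt i k s

  point≡ι : ∀ c → point c ≡ (ι (x₀ (proj₁ c)) , ι (y₀ (proj₁ c)) , ι (altitude c))
  point≡ι (X , s) = cong₂ _,_ (sym ι-0) (cong₂ _,_ (sym ι-0) (/m≡ι X s))
  point≡ι (Y , s) = cong₂ _,_ (trans (cong₂ ℚ._+_ (inv≡ι X) (inv≡ι Y)) (ι-+ (h X) (h Y)))
                              (cong₂ _,_ (sym ι-0) (/m≡ι Y s))
  point≡ι (Z , s) = cong₂ _,_ (inv≡ι X) (cong₂ _,_ (inv≡ι Z) (/m≡ι Z s))

  dist-point : ∀ c c' → dist (point c) (point c') ≡ ι (gridDist c c')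
  dist-point (L , s) (L' , s') = trans (cong₂ dist (point≡ι (L , s)) (point≡ι (L' , s')))
    (dist-ι (x₀ L) (y₀ L) (s * h L) (x₀ L') (y₀ L') (s' * h L'))

  I3≡points : I3 i j k ≡ map point allCodes
  I3≡points = sym (begin
    map point (xs ++ ys ++ zs)                    ≡⟨ map-++ point xs (ys ++ zs) ⟩
    map point xs ++ map point (ys ++ zs)          ≡⟨ cong (map point xs ++_) (map-++ point ys zs) ⟩
    map point xs ++ map point ys ++ map point zs  ≡⟨ cong₂ _++_ (map-∘ (upTo (suc (m X))))
                                                       (cong₂ _++_ (map-∘ (upTo (suc (m Y)))) (map-∘ (upTo (suc (m Z))))) ⟨
    I3 i j k                                      ∎)
    where
    open ≡-Reasoning
    xs ys zs : List Code
    xs = map (X ,_) (upTo (suc (m X)))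
    ys = map (Y ,_) (upTo (suc (m Y)))
    zs = map (Z ,_) (upTo (suc (m Z)))

  bound≡ι : (+ 4) / 1 ℚ.+ (+ 2) / suc i ℚ.+ (+ 2) / suc j ℚ.+ (+ 2) / suc k ≡ ι (4 * N + 2 * lineSum h)
  bound≡ι = begin
    (+ 4) / 1 ℚ.+ (+ 2) / m X ℚ.+ (+ 2) / m Y ℚ.+ (+ 2) / m Z
      ≡⟨ cong₂ ℚ._+_ (cong₂ ℚ._+_ (cong₂ ℚ._+_ (/-cross 4 (4 * N) 0 (ℕ.pred N) (sym (*-identityʳ (4 * N))))
                                              (/m≡ι X 2))
                                  (/m≡ι Y 2))
                     (/m≡ι Z 2) ⟩
    ι (4 * N) ℚ.+ ι (2 * h X) ℚ.+ ι (2 * h Y) ℚ.+ ι (2 * h Z)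
      ≡⟨ cong (λ q → q ℚ.+ ι (2 * h Y) ℚ.+ ι (2 * h Z)) (ι-+ (4 * N) (2 * h X)) ⟩
    ι (4 * N + 2 * h X) ℚ.+ ι (2 * h Y) ℚ.+ ι (2 * h Z)
      ≡⟨ cong (ℚ._+ ι (2 * h Z)) (ι-+ (4 * N + 2 * h X) (2 * h Y)) ⟩
    ι (4 * N + 2 * h X + 2 * h Y) ℚ.+ ι (2 * h Z)
      ≡⟨ ι-+ (4 * N + 2 * h X + 2 * h Y) (2 * h Z) ⟩
    ι (4 * N + 2 * h X + 2 * h Y + 2 * h Z)
      ≡⟨ cong ι (ring (4 * N) (h X) (h Y) (h Z)) ⟩
    ι (4 * N + 2 * lineSum h) ∎
    where
    open ≡-Reasoning
    ring : ∀ n a b c → n + 2 * a + 2 * b + 2 * c ≡ n + 2 * (a + b + c)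
    ring = solve-∀

  tour-length : ∀ T → T ↭ I3 i j k → ι (4 * N + 2 * lineSum h) ℚ.≤ cycleLength T
  tour-length T tour with ↭-map-inv point (↭-sym (subst (T ↭_) I3≡points tour))
  ... | cs , refl , perm = begin
    ι (4 * N + 2 * lineSum h)   ≤⟨ ι-mono-≤ (Tour.tour-bound cs perm) ⟩
    ι (cycleSum gridDist cs)    ≡⟨ cycleLength-map (ℕ.pred N) point gridDist dist-point cs ⟨
    cycleLength (map point cs)  ∎
    where open ℚ.≤-Reasoning

mainTheorem9 : (i j k : ℕ) (T : List Point) → IsOptimalTour (I3 i j k) T →
    (+ 4) / 1 ℚ.+ (+ 2) / ℕ.suc i ℚ.+ (+ 2) / ℕ.suc j ℚ.+ (+ 2) / ℕ.suc k ℚ.≤ cycleLength T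
mainTheorem9 i j k T (tour , _) = subst (ℚ._≤ cycleLength T) (sym (bound≡ι)) (tour-length T tour)
  where open Instance i j k
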